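{- For all integers $n,m\geq 3$ there exist pairwise-disjoint sets $A_1,\dots,A_n$ with $|A_i|=m$ for each $i$ and $A_1\cup\dots\cup A_n=\{1,2,\dots,nm\}$ (a set of $n$ $m$-sided dice) which are non-transitive and balanced. That is, $P(A_i\succ A_{i+1})>\tfrac12$ for $1\le i\le n-1$ and $P(A_n\succ A_1)>\tfrac12$, and moreover $P(A_1\succ A_2)=P(A_2\succ A_3)=\dots=P(A_{n-1}\succ A_n)=P(A_n\succ A_1)$.
   Context: A set of $n$ $m$-sided dice is a collection of pairwise-disjoint sets $A_1,\dots,A_n$ with $|A_i|=m$ and $\bigcup_i A_i=\{1,\dots,nm\}$. Die $A_i$ is thought of as labeled with the elements of $A_i$, and each label is rolled with probability $1/m$. For two dice $A,B$, $P(A\succ B)$ denotes the probability that, when $A$ and $B$ are rolled independently, the number shown on $A$ exceeds the number shown on $B$; equivalently, $P(A\succ B)=|\{(a,b)\in A\times B: a>b\}|/m^2$. One writes $A\succ B$ if $P(A\succ B)>\tfrac12$. The set $A_1,\dots,A_n$ is non-transitive if $A_i\succ A_{i+1}$ for all $i<n$ and $A_n\succ A_1$. It is balanced if all the probabilities $P(A_i\succ A_{i+1})$ for $i<n$, together with $P(A_n\succ A_1)$, are equal. -}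

module Defs where

open import Data.Nat using (ℕ; zero; suc; _+_; _*_; _<_; _<ᵇ_)
open import Data.Nat.Properties using (_≟_)
open import Data.Fin using (Fin; toℕ)
open import Data.Fin.Properties using () renaming (_≟_ to _≟ᶠ_)
open import Data.List using (List; length; filter; allFin; cartesianProduct)
open import Data.Product using (_×_; _,_; proj₁; proj₂)
open import Relation.Nullary.Decidable using (_×-dec_; ⌊_⌋)
open import Relation.Binary.PropositionalEquality using (_≡_)
open import Data.Nat.Properties using (_<?_)

-- A set of n m-sided dice is encoded as an assignment
--   die : Fin (n * m) → Fin n
-- where the label k ∈ Fin (n * m) stands for the number (toℕ k + 1) ∈ {1,…,nm},
-- and die k = i means that this number lies on die A_i (dice indexed 0,…,n-1).
-- Such an assignment is exactly a partition of {1,…,nm} into pairwise-disjoint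
-- sets A_0,…,A_{n-1}; the condition |A_i| = m is imposed separately.
Assignment : ℕ → ℕ → Set
Assignment n m = Fin (n * m) → Fin n

faces : ∀ {n m} → Assignment n m → Fin n → List (Fin (n * m))
faces {n} {m} die i = filter (λ k → die k ≟ᶠ i) (allFin (n * m))

size : ∀ {n m} → Assignment n m → Fin n → ℕ
size die i = length (faces die i)

-- wins die i j = |{(a,b) ∈ A_i × A_j : a > b}|, so that
-- P(A_i ≻ A_j) = wins die i j / m².
wins : ∀ {n m} → Assignment n m → Fin n → Fin n → ℕ
wins die i j =
  length (filter (λ p → toℕ (proj₂ p) <? toℕ (proj₁ p))
                 (cartesianProduct (faces die i) (faces die j)))

-- A_i ≻ A_j  iff  P(A_i ≻ A_j) > 1/2  iff  2 · wins > m²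
Beats : ∀ {n m} → Assignment n m → Fin n → Fin n → Set
Beats {n} {m} die i j = m * m < 2 * wins die i j

open import Data.Fin using (fromℕ<)
open import Data.Fin.Properties using (toℕ<n)
open import Data.Nat using (z≤n; s≤s)
open import Data.Nat.Properties using (≤-trans)
open import Relation.Nullary using (yes; no)

-- Consecutive pairs in the cycle A_1 → A_2 → … → A_n → A_1, where the
-- paper's die A_{k+1} is our die k : Fin n.
-- next k = k + 1 if k + 1 < n, and next (n-1) = 0.
next : ∀ {n} → Fin n → Fin n
next {n} k with suc (toℕ k) <? n
... | yes p = fromℕ< p
... | no _  = fromℕ< {0} (≤-trans (s≤s z≤n) (toℕ<n k))

module Submission where

-- A set of dice is encoded as a word over the alphabet {0,…,n-1}: the letter
-- at position p names the die carrying the number p + 1.  In a word, the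
-- number of wins of die i over die j is the number of pairs of positions
-- p < q whose letters are j and i (wordWins).  The construction is built from
-- "blocks": words containing every letter exactly once.  If a word is a
-- concatenation of b blocks, every die has b faces and each ordered pair of
-- dice gets b(b-1)/2 wins from pairs of faces lying in different blocks, plus
-- its wins inside the blocks.  So it suffices to choose blocks whose inside
-- wins agree on every cyclically consecutive pair (i, i+1 mod n).
--   * Blocks of the shape  r-1,…,0 followed by r,…,n-1 or by n-1,…,r  have
--     explicitly computable inside wins (descAsc-step, descDesc-step, …).
--   * Three such blocks give a balanced word for m = 3, four for m = 4 and
--     n ≥ 4; the case n = 3, m = 4 is settled by one explicit word of length 12.
--   * Appending the blocks 0,…,n-1 and n-1,…,0 keeps a word balanced and
--     non-transitive while adding two faces to every die (extend).

open import Defs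
open import Data.Bool using (true; false; if_then_else_)
open import Data.Fin using (Fin; toℕ; fromℕ<)
open import Data.Fin.Properties using (toℕ-injective; toℕ-fromℕ<; toℕ<n) renaming (_≟_ to _≟ᶠ_)
open import Data.List using (List; []; _∷_; _++_; [_]; length; reverse; concat; map; filter; allFin; cartesianProduct; tabulate)
open import Data.List.Properties using (unfold-reverse; length-reverse; length-++; filter-++; filter-none; filter-accept; map-tabulate; tabulate-cong)
open import Data.List.Relation.Binary.Pointwise using (Pointwise; []; _∷_)
open import Data.List.Relation.Unary.All as All using (All; []; _∷_)
open import Data.List.Relation.Unary.All.Properties using (++⁺; concat⁺; map⁺; filter⁺)
open import Data.List.Relation.Unary.AllPairs using (AllPairs; []; _∷_)
open import Data.List.Relation.Unary.AllPairs.Properties using (tabulate⁺-<)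
open import Data.Nat using (ℕ; zero; suc; _+_; _*_; _≤_; _<_; _≥_; z≤n; s≤s; z<s; _<ᵇ_; _≡ᵇ_)
open import Data.Nat.ListAction using (sum)
open import Data.Nat.Properties
open import Data.Nat.Tactic.RingSolver using (solve-∀)
open import Data.Product using (Σ; _×_; _,_; proj₁; proj₂)
open import Function using (_∘_; id)
open import Relation.Binary.PropositionalEquality using (_≡_; _≢_; refl; sym; trans; cong; cong₂; subst; module ≡-Reasoning)
open import Relation.Nullary using (Dec; yes; no; contradiction)
open import Relation.Nullary.Decidable using (from-yes)
open import Relation.Nullary.Reflects using (Reflects; ofʸ; ofⁿ; fromEquivalence)

count : ℕ → List ℕ → ℕ
count c []      = 0
count c (x ∷ w) with x ≟ c
... | yes _ = suc (count c w)
... | no  _ = count c w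

wordWins : ℕ → ℕ → List ℕ → ℕ
wordWins i j []      = 0
wordWins i j (x ∷ w) with x ≟ j
... | yes _ = count i w + wordWins i j w
... | no  _ = wordWins i j w

count-++ : ∀ c u v → count c (u ++ v) ≡ count c u + count c v
count-++ c []      v = refl
count-++ c (x ∷ u) v with x ≟ c
... | yes _ = cong suc (count-++ c u v)
... | no  _ = count-++ c u v

wordWins-++ : ∀ i j u v →
  wordWins i j (u ++ v) ≡ wordWins i j u + wordWins i j v + count i v * count j u
wordWins-++ i j [] v = sym (trans (cong (wordWins i j v +_) (*-zeroʳ (count i v))) (+-identityʳ _))
wordWins-++ i j (x ∷ u) v with x ≟ j
... | no  _ = wordWins-++ i j u v
... | yes _ = begin
  count i (u ++ v) + wordWins i j (u ++ v)
    ≡⟨ cong₂ _+_ (count-++ i u v) (wordWins-++ i j u v) ⟩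
  count i u + count i v + (wordWins i j u + wordWins i j v + count i v * count j u)
    ≡⟨ regroup (count i u) (count i v) (wordWins i j u) (wordWins i j v) (count j u) ⟩
  count i u + wordWins i j u + wordWins i j v + count i v * suc (count j u) ∎
  where
  open ≡-Reasoning
  regroup : ∀ a b c d e → a + b + (c + d + b * e) ≡ a + c + d + b * suc e
  regroup = solve-∀

wordWins-++-≡ : ∀ {i j a b c d} U V → wordWins i j U ≡ a → wordWins i j V ≡ b →
                count i V ≡ c → count j U ≡ d → wordWins i j (U ++ V) ≡ a + b + c * d
wordWins-++-≡ {i} {j} U V p q r s =
  trans (wordWins-++ i j U V) (cong₂ _+_ (cong₂ _+_ p q) (cong₂ _*_ r s))

wordWins-single : ∀ i j x → wordWins i j [ x ] ≡ 0
wordWins-single i j x with x ≟ j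
... | yes _ = refl
... | no  _ = refl

count-reverse : ∀ c w → count c (reverse w) ≡ count c w
count-reverse c []      = refl
count-reverse c (x ∷ w) = begin
  count c (reverse (x ∷ w))            ≡⟨ cong (count c) (unfold-reverse x w) ⟩
  count c (reverse w ++ [ x ])         ≡⟨ count-++ c (reverse w) [ x ] ⟩
  count c (reverse w) + count c [ x ]  ≡⟨ cong (_+ count c [ x ]) (count-reverse c w) ⟩
  count c w + count c [ x ]            ≡⟨ +-comm (count c w) _ ⟩
  count c [ x ] + count c w            ≡⟨ count-++ c [ x ] w ⟨
  count c (x ∷ w)                      ∎
  where open ≡-Reasoning

wordWins-reverse : ∀ i j w → wordWins i j (reverse w) ≡ wordWins j i w
wordWins-reverse i j []      = refl
wordWins-reverse i j (x ∷ w) = begin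
  wordWins i j (reverse (x ∷ w))
    ≡⟨ cong (wordWins i j) (unfold-reverse x w) ⟩
  wordWins i j (reverse w ++ [ x ])
    ≡⟨ wordWins-++-≡ (reverse w) [ x ] (wordWins-reverse i j w) (wordWins-single i j x) refl (count-reverse j w) ⟩
  wordWins j i w + 0 + count i [ x ] * count j w
    ≡⟨ swap (wordWins j i w) (count i [ x ]) (count j w) ⟩
  wordWins j i w + count j w * count i [ x ]
    ≡⟨ wordWins-++-≡ [ x ] w (wordWins-single j i x) refl refl refl ⟨
  wordWins j i (x ∷ w) ∎
  where
  open ≡-Reasoning
  swap : ∀ a b c → a + 0 + b * c ≡ a + c * b
  swap = solve-∀

wordWins-absentˡ : ∀ i j w → count i w ≡ 0 → wordWins i j w ≡ 0
wordWins-absentˡ i j []      _ = refl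
wordWins-absentˡ i j (x ∷ w) h with x ≟ i | x ≟ j
... | yes _ | _     = contradiction h λ ()
... | no  _ | yes _ = trans (cong (_+ wordWins i j w) h) (wordWins-absentˡ i j w h)
... | no  _ | no  _ = wordWins-absentˡ i j w h

wordWins-absentʳ : ∀ i j w → count j w ≡ 0 → wordWins i j w ≡ 0
wordWins-absentʳ i j []      _ = refl
wordWins-absentʳ i j (x ∷ w) h with x ≟ j
... | yes _ = contradiction h λ ()
... | no  _ = wordWins-absentʳ i j w h

asc : ℕ → ℕ → List ℕ
asc s zero    = []
asc s (suc k) = s ∷ asc (suc s) k

desc : ℕ → ℕ → List ℕ
desc s k = reverse (asc s k)

record Run (s k : ℕ) (T : List ℕ) : Set where
  field
    length-run : length T ≡ k
    bounded    : All (_< s + k) T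
    below      : ∀ {c} → c < s → count c T ≡ 0
    inside     : ∀ {c} → s ≤ c → c < s + k → count c T ≡ 1
    above      : ∀ {c} → s + k ≤ c → count c T ≡ 0

count-asc-below : ∀ {c} s k → c < s → count c (asc s k) ≡ 0
count-asc-below s zero    c<s = refl
count-asc-below {c} s (suc k) c<s with s ≟ c
... | yes refl = contradiction c<s (n≮n c)
... | no  _    = count-asc-below (suc s) k (m<n⇒m<1+n c<s)

count-asc-above : ∀ {c} s k → s + k ≤ c → count c (asc s k) ≡ 0
count-asc-above s zero    _ = refl
count-asc-above {c} s (suc k) s+k≤c with s ≟ c
... | yes refl = contradiction s+k≤c (<⇒≱ (m<m+n s z<s))
... | no  _    = count-asc-above (suc s) k (≤-trans (≤-reflexive (sym (+-suc s k))) s+k≤c)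

count-asc-inside : ∀ {c} s k → s ≤ c → c < s + k → count c (asc s k) ≡ 1
count-asc-inside {c} s zero    s≤c c<s+0 = contradiction (subst (c <_) (+-identityʳ s) c<s+0) (≤⇒≯ s≤c)
count-asc-inside {c} s (suc k) s≤c c<s+k with s ≟ c
... | yes refl = cong suc (count-asc-below (suc s) k (n<1+n s))
... | no  s≢c  = count-asc-inside (suc s) k (≤∧≢⇒< s≤c s≢c) (subst (c <_) (+-suc s k) c<s+k)

asc-bounded : ∀ s k → All (_< s + k) (asc s k)
asc-bounded s zero    = []
asc-bounded s (suc k) =
  m<m+n s z<s ∷ subst (λ b → All (_< b) (asc (suc s) k)) (sym (+-suc s k)) (asc-bounded (suc s) k)

length-asc : ∀ s k → length (asc s k) ≡ k
length-asc s zero    = refl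
length-asc s (suc k) = cong suc (length-asc (suc s) k)

asc-run : ∀ s k → Run s k (asc s k)
asc-run s k = record
  { length-run = length-asc s k
  ; bounded    = asc-bounded s k
  ; below      = count-asc-below s k
  ; inside     = count-asc-inside s k
  ; above      = count-asc-above s k
  }

All-reverse : ∀ {P : ℕ → Set} w → All P w → All P (reverse w)
All-reverse []      []        = []
All-reverse (x ∷ w) (px ∷ pw) =
  subst (All _) (sym (unfold-reverse x w)) (++⁺ (All-reverse w pw) (px ∷ []))

reverse-run : ∀ {s k T} → Run s k T → Run s k (reverse T)
reverse-run {T = T} r = record
  { length-run = trans (length-reverse T) length-run
  ; bounded    = All-reverse T bounded
  ; below      = λ c<s → trans (count-reverse _ T) (below c<s)
  ; inside     = λ s≤c c<s+k → trans (count-reverse _ T) (inside s≤c c<s+k)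
  ; above      = λ s+k≤c → trans (count-reverse _ T) (above s+k≤c)
  }
  where open Run r

desc-run : ∀ s k → Run s k (desc s k)
desc-run s k = reverse-run (asc-run s k)

run-++ : ∀ {s k l U V} → Run s k U → Run (s + k) l V → Run s (k + l) (U ++ V)
run-++ {s} {k} {l} {U} {V} ru rv = record
  { length-run = trans (length-++ U) (cong₂ _+_ (Run.length-run ru) (Run.length-run rv))
  ; bounded    = ++⁺ (All.map (λ x<s+k → <-≤-trans x<s+k s+k≤s+[k+l]) (Run.bounded ru))
                     (subst (λ b → All (_< b) V) (+-assoc s k l) (Run.bounded rv))
  ; below      = λ c<s → split-count (Run.below ru c<s) (Run.below rv (<-≤-trans c<s (m≤m+n s k)))
  ; inside     = inside
  ; above      = λ h → split-count (Run.above ru (≤-trans s+k≤s+[k+l] h))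
                                   (Run.above rv (≤-trans (≤-reflexive (+-assoc s k l)) h))
  }
  where
  s+k≤s+[k+l] : s + k ≤ s + (k + l)
  s+k≤s+[k+l] = +-monoʳ-≤ s (m≤m+n k l)

  split-count : ∀ {c a b} → count c U ≡ a → count c V ≡ b → count c (U ++ V) ≡ a + b
  split-count {c} p q = trans (count-++ c U V) (cong₂ _+_ p q)

  inside : ∀ {c} → s ≤ c → c < s + (k + l) → count c (U ++ V) ≡ 1
  inside {c} s≤c c<end with c <? s + k
  ... | yes c<s+k = split-count (Run.inside ru s≤c c<s+k) (Run.below rv c<s+k)
  ... | no  c≮s+k = split-count (Run.above ru (≮⇒≥ c≮s+k))
                                (Run.inside rv (≮⇒≥ c≮s+k) (subst (c <_) (sym (+-assoc s k l)) c<end))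

wordWins-asc-ordered : ∀ {i j} s k → i < j → wordWins i j (asc s k) ≡ 0
wordWins-asc-ordered s zero    _   = refl
wordWins-asc-ordered {i} {j} s (suc k) i<j with s ≟ j
... | yes refl = trans (cong (_+ wordWins i s (asc (suc s) k)) (count-asc-below (suc s) k (m<n⇒m<1+n i<j)))
                       (wordWins-asc-ordered (suc s) k i<j)
... | no  _    = wordWins-asc-ordered (suc s) k i<j

wordWins-asc-inverted : ∀ {i j} s k → s ≤ j → j < i → i < s + k → wordWins i j (asc s k) ≡ 1
wordWins-asc-inverted {i} s zero s≤j j<i i<s+0 =
  contradiction (subst (i <_) (+-identityʳ s) i<s+0) (≤⇒≯ (≤-trans s≤j (<⇒≤ j<i)))
wordWins-asc-inverted {i} {j} s (suc k) s≤j j<i i<end with s ≟ j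
... | yes refl = cong₂ _+_ (count-asc-inside (suc s) k j<i (subst (i <_) (+-suc s k) i<end))
                           (wordWins-absentʳ i s (asc (suc s) k) (count-asc-below (suc s) k (n<1+n s)))
... | no  s≢j  = wordWins-asc-inverted (suc s) k (≤∧≢⇒< s≤j s≢j) j<i (subst (i <_) (+-suc s k) i<end)

prefix-below : ∀ {i r} T → suc i < r → count i T ≡ 0 → wordWins i (suc i) (desc 0 r ++ T) ≡ 1
prefix-below {i} {r} T i+1<r i∉T = wordWins-++-≡ (desc 0 r) T
  (trans (wordWins-reverse i (suc i) (asc 0 r)) (wordWins-asc-inverted 0 r z≤n (n<1+n i) i+1<r))
  (wordWins-absentˡ i (suc i) T i∉T)
  i∉T
  (Run.inside (desc-run 0 r) z≤n i+1<r)

prefix-above : ∀ {i r} T → r ≤ suc i → wordWins i (suc i) (desc 0 r ++ T) ≡ wordWins i (suc i) T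
prefix-above {i} {r} T r≤i+1 = begin
  wordWins i (suc i) (desc 0 r ++ T)
    ≡⟨ wordWins-++-≡ (desc 0 r) T (wordWins-absentʳ i (suc i) (desc 0 r) i+1∉D) refl refl i+1∉D ⟩
  0 + wordWins i (suc i) T + count i T * 0
    ≡⟨ cong (wordWins i (suc i) T +_) (*-zeroʳ (count i T)) ⟩
  wordWins i (suc i) T + 0
    ≡⟨ +-identityʳ _ ⟩
  wordWins i (suc i) T ∎
  where
  open ≡-Reasoning
  i+1∉D : count (suc i) (desc 0 r) ≡ 0
  i+1∉D = Run.above (desc-run 0 r) r≤i+1

prefix-wrap : ∀ {i r} T → 0 < r → r ≤ i → count i T ≡ 1 → count 0 T ≡ 0 → wordWins i 0 (desc 0 r ++ T) ≡ 1
prefix-wrap {i} {r} T 0<r r≤i i∈T 0∉T = wordWins-++-≡ (desc 0 r) T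
  (wordWins-absentˡ i 0 (desc 0 r) (Run.above (desc-run 0 r) r≤i))
  (wordWins-absentʳ i 0 T 0∉T)
  i∈T
  (Run.inside (desc-run 0 r) z≤n 0<r)

descAsc : ℕ → ℕ → List ℕ
descAsc r t = desc 0 r ++ asc r t

descDesc : ℕ → ℕ → List ℕ
descDesc r t = desc 0 r ++ desc r t

descAsc-run : ∀ r t → Run 0 (r + t) (descAsc r t)
descAsc-run r t = run-++ (desc-run 0 r) (asc-run r t)

descDesc-run : ∀ r t → Run 0 (r + t) (descDesc r t)
descDesc-run r t = run-++ (desc-run 0 r) (desc-run r t)

-- The values are stated through boolean
-- tests so that they compute once i and r are numerals or successors.
descAsc-step : ∀ r t {i} → suc i < r + t →
               wordWins i (suc i) (descAsc r t) ≡ (if suc i <ᵇ r then 1 else 0)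
descAsc-step r t {i} i+1<n with suc i <ᵇ r | <ᵇ-reflects-< (suc i) r
... | true  | ofʸ i+1<r = prefix-below (asc r t) i+1<r (count-asc-below r t (<-trans (n<1+n i) i+1<r))
... | false | ofⁿ i+1≮r = trans (prefix-above (asc r t) (≮⇒≥ i+1≮r)) (wordWins-asc-ordered r t (n<1+n i))

≡ᵇ-reflects-≡ : ∀ m n → Reflects (m ≡ n) (m ≡ᵇ n)
≡ᵇ-reflects-≡ m n = fromEquivalence (≡ᵇ⇒≡ m n) (≡⇒≡ᵇ m n)

descDesc-step : ∀ r t {i} → suc i < r + t →
                wordWins i (suc i) (descDesc r t) ≡ (if suc i ≡ᵇ r then 0 else 1)
descDesc-step r t {i} i+1<n with suc i ≡ᵇ r | ≡ᵇ-reflects-≡ (suc i) r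
... | true  | ofʸ refl = trans (prefix-above (desc r t) ≤-refl)
                               (wordWins-absentˡ i r (desc r t) (Run.below (desc-run r t) (n<1+n i)))
... | false | ofⁿ i+1≢r with suc i <? r
...   | yes i+1<r = prefix-below (desc r t) i+1<r (Run.below (desc-run r t) (<-trans (n<1+n i) i+1<r))
...   | no  i+1≮r = begin
  wordWins i (suc i) (descDesc r t)  ≡⟨ prefix-above (desc r t) (≮⇒≥ i+1≮r) ⟩
  wordWins i (suc i) (desc r t)      ≡⟨ wordWins-reverse i (suc i) (asc r t) ⟩
  wordWins (suc i) i (asc r t)       ≡⟨ wordWins-asc-inverted r t r≤i (n<1+n i) i+1<n ⟩
  1                                  ∎
  where
  open ≡-Reasoning
  r≤i : r ≤ i
  r≤i = ≤-pred (≤∧≢⇒< (≮⇒≥ i+1≮r) (i+1≢r ∘ sym))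

descAsc-wrap : ∀ r t {i} → 0 < i → r ≤ i → i < r + t → wordWins i 0 (descAsc r t) ≡ 1
descAsc-wrap zero    t 0<i _ i<t = wordWins-asc-inverted 0 t z≤n 0<i i<t
descAsc-wrap (suc r) t 0<i r≤i i<n =
  prefix-wrap (asc (suc r) t) z<s r≤i (count-asc-inside (suc r) t r≤i i<n) (count-asc-below (suc r) t z<s)

descDesc-wrap : ∀ r t {i} → 0 < i → r ≤ i → i < r + t →
                wordWins i 0 (descDesc r t) ≡ (if 0 <ᵇ r then 1 else 0)
descDesc-wrap zero    t {i} 0<i _ _ = trans (wordWins-reverse i 0 (asc 0 t)) (wordWins-asc-ordered 0 t 0<i)
descDesc-wrap (suc r) t 0<i r≤i i<n = prefix-wrap (desc (suc r) t) z<s r≤i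
  (Run.inside (desc-run (suc r) t) r≤i i<n) (Run.below (desc-run (suc r) t) z<s)

-- triangle b = b(b-1)/2, the number of pairs of distinct blocks among b.
triangle : ℕ → ℕ
triangle zero    = 0
triangle (suc b) = b + triangle b

module _ {n : ℕ} where

  concat-length : ∀ {Bs} → All (Run 0 n) Bs → length (concat Bs) ≡ n * length Bs
  concat-length {[]}     []       = sym (*-zeroʳ n)
  concat-length {B ∷ Bs} (r ∷ rs) = begin
    length (B ++ concat Bs)           ≡⟨ length-++ B ⟩
    length B + length (concat Bs)     ≡⟨ cong₂ _+_ (Run.length-run r) (concat-length rs) ⟩
    n + n * length Bs                 ≡⟨ *-suc n (length Bs) ⟨
    n * suc (length Bs)               ∎
    where open ≡-Reasoning

  concat-bounded : ∀ {Bs} → All (Run 0 n) Bs → All (_< n) (concat Bs)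
  concat-bounded rs = concat⁺ (All.map Run.bounded rs)

  concat-count : ∀ {c Bs} → c < n → All (Run 0 n) Bs → count c (concat Bs) ≡ length Bs
  concat-count              c<n []       = refl
  concat-count {c} {B ∷ Bs} c<n (r ∷ rs) =
    trans (count-++ c B (concat Bs)) (cong₂ _+_ (Run.inside r z≤n c<n) (concat-count c<n rs))

  concat-wins : ∀ {i j Bs} → i < n → j < n → All (Run 0 n) Bs →
                wordWins i j (concat Bs) ≡ sum (map (wordWins i j) Bs) + triangle (length Bs)
  concat-wins                  i<n j<n []       = refl
  concat-wins {i} {j} {B ∷ Bs} i<n j<n (r ∷ rs) = begin
    wordWins i j (B ++ concat Bs)
      ≡⟨ wordWins-++-≡ B (concat Bs) refl (concat-wins i<n j<n rs) (concat-count i<n rs) (Run.inside r z≤n j<n) ⟩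
    wordWins i j B + (sum (map (wordWins i j) Bs) + triangle (length Bs)) + length Bs * 1
      ≡⟨ regroup (wordWins i j B) (sum (map (wordWins i j) Bs)) (triangle (length Bs)) (length Bs) ⟩
    wordWins i j B + sum (map (wordWins i j) Bs) + (length Bs + triangle (length Bs)) ∎
    where
    open ≡-Reasoning
    regroup : ∀ a s t b → a + (s + t) + b * 1 ≡ a + s + (b + t)
    regroup = solve-∀

sum-map-≡ : ∀ {A : Set} (f : A → ℕ) xs {vs} → Pointwise (λ x v → f x ≡ v) xs vs → sum (map f xs) ≡ sum vs
sum-map-≡ f []       []       = refl
sum-map-≡ f (x ∷ xs) (p ∷ ps) = cong₂ _+_ p (sum-map-≡ f xs ps)

data CyclicSucc : ℕ → ℕ → ℕ → Set where
  step : ∀ {n i} → suc i < n → CyclicSucc n i (suc i)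
  wrap : ∀ {i} → CyclicSucc (suc i) i 0

cyclic-bounds : ∀ {n i j} → CyclicSucc n i j → i < n × j < n
cyclic-bounds (step i+1<n) = <-trans (n<1+n _) i+1<n , i+1<n
cyclic-bounds wrap         = n<1+n _ , z<s

record BalancedWord (n m : ℕ) : Set where
  field
    word        : List ℕ
    winCount    : ℕ
    length-word : length word ≡ n * m
    letters     : All (_< n) word
    counts      : ∀ {c} → c < n → count c word ≡ m
    balanced    : ∀ {i j} → CyclicSucc n i j → wordWins i j word ≡ winCount
    majority    : m * m < 2 * winCount

fromBlocks : ∀ {n} Bs S → All (Run 0 n) Bs →
             (∀ {i j} → CyclicSucc n i j → sum (map (wordWins i j) Bs) ≡ S) →
             length Bs * length Bs < 2 * (S + triangle (length Bs)) →
             BalancedWord n (length Bs)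
fromBlocks Bs S rs sums maj = record
  { word        = concat Bs
  ; winCount    = S + triangle (length Bs)
  ; length-word = concat-length rs
  ; letters     = concat-bounded rs
  ; counts      = λ c<n → concat-count c<n rs
  ; balanced    = λ p → let (i<n , j<n) = cyclic-bounds p in
                    trans (concat-wins i<n j<n rs) (cong (_+ triangle (length Bs)) (sums p))
  ; majority    = maj
  }

ascThenDesc : ℕ → List (List ℕ)
ascThenDesc n = descAsc 0 n ∷ descDesc 0 n ∷ []

ascThenDesc-runs : ∀ n → All (Run 0 n) (ascThenDesc n)
ascThenDesc-runs n = descAsc-run 0 n ∷ descDesc-run 0 n ∷ []

ascThenDesc-sum : ∀ {n i j} → 2 ≤ n → CyclicSucc n i j → sum (map (wordWins i j) (ascThenDesc n)) ≡ 1
ascThenDesc-sum {n} {i} _ (step i+1<n) =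
  sum-map-≡ (wordWins i (suc i)) (ascThenDesc n) (descAsc-step 0 n i+1<n ∷ descDesc-step 0 n i+1<n ∷ [])
ascThenDesc-sum {_} {i} (s≤s 1≤i) wrap = sum-map-≡ (wordWins i 0) (ascThenDesc (suc i))
  (descAsc-wrap 0 (suc i) 1≤i z≤n (n<1+n i) ∷ descDesc-wrap 0 (suc i) 1≤i z≤n (n<1+n i) ∷ [])

-- Appending those two blocks adds two faces to each die and 2 + 2m wins to
-- each cyclic pair, which preserves  m² < 2 · winCount.
extend : ∀ {n m} → 2 ≤ n → BalancedWord n m → BalancedWord n (2 + m)
extend {n} {m} 2≤n b = record
  { word        = word ++ concat (ascThenDesc n)
  ; winCount    = winCount + 2 + 2 * m
  ; length-word = trans (length-++ word) (trans (cong₂ _+_ length-word (concat-length (ascThenDesc-runs n)))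
                                                (trans (+-comm (n * m) (n * 2)) (sym (*-distribˡ-+ n 2 m))))
  ; letters     = ++⁺ letters (concat-bounded (ascThenDesc-runs n))
  ; counts      = λ c<n → trans (count-++ _ word _)
                            (trans (cong₂ _+_ (counts c<n) (concat-count c<n (ascThenDesc-runs n))) (+-comm m 2))
  ; balanced    = balanced′
  ; majority    = majority′
  }
  where
  open BalancedWord b

  balanced′ : ∀ {i j} → CyclicSucc n i j → wordWins i j (word ++ concat (ascThenDesc n)) ≡ winCount + 2 + 2 * m
  balanced′ p = let (i<n , j<n) = cyclic-bounds p in
    wordWins-++-≡ word (concat (ascThenDesc n)) (balanced p)
      (trans (concat-wins i<n j<n (ascThenDesc-runs n)) (cong (_+ 1) (ascThenDesc-sum 2≤n p)))
      (concat-count i<n (ascThenDesc-runs n)) (counts j<n)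

  majority′ : (2 + m) * (2 + m) < 2 * (winCount + 2 + 2 * m)
  majority′ = begin-strict
    (2 + m) * (2 + m)          ≡⟨ expand m ⟩
    m * m + (4 + 4 * m)        <⟨ +-monoˡ-< (4 + 4 * m) majority ⟩
    2 * winCount + (4 + 4 * m) ≡⟨ collect winCount m ⟩
    2 * (winCount + 2 + 2 * m) ∎
    where
    open ≤-Reasoning
    expand : ∀ m → (2 + m) * (2 + m) ≡ m * m + (4 + 4 * m)
    expand = solve-∀
    collect : ∀ w m → 2 * w + (4 + 4 * m) ≡ 2 * (w + 2 + 2 * m)
    collect = solve-∀

-- Base cases m = 3 and m = 4; the sums are evaluated by the block values above,
-- after splitting i so that the boolean tests compute.

-- For n = 3 + k:  n-1,…,0 | 0, n-1,…,1 | 1, 0, 2,…,n-1.  Inside wins 2 on every pair.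
threeBlocks : ℕ → List (List ℕ)
threeBlocks k = descDesc 0 (3 + k) ∷ descDesc 1 (2 + k) ∷ descAsc 2 (1 + k) ∷ []

threeBlocks-sum : ∀ {k i j} → CyclicSucc (3 + k) i j → sum (map (wordWins i j) (threeBlocks k)) ≡ 2
threeBlocks-sum {k} {i} (step lt) = case i lt
  where
  values : ∀ {i} → suc i < 3 + k → Pointwise (λ B v → wordWins i (suc i) B ≡ v) (threeBlocks k) _
  values lt = descDesc-step 0 (3 + k) lt ∷ descDesc-step 1 (2 + k) lt ∷ descAsc-step 2 (1 + k) lt ∷ []
  case : ∀ i (lt : suc i < 3 + k) → sum (map (wordWins i (suc i)) (threeBlocks k)) ≡ 2
  case zero    lt = sum-map-≡ _ (threeBlocks k) (values lt)
  case (suc i) lt = sum-map-≡ _ (threeBlocks k) (values lt)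
threeBlocks-sum {k} wrap = sum-map-≡ (wordWins (2 + k) 0) (threeBlocks k)
  (descDesc-wrap 0 (3 + k) 1≤ z≤n (n<1+n _) ∷ descDesc-wrap 1 (2 + k) 1≤ 1≤ (n<1+n _) ∷
   descAsc-wrap 2 (1 + k) 1≤ (s≤s (s≤s z≤n)) (n<1+n _) ∷ [])
  where
  1≤ : 1 ≤ 2 + k
  1≤ = s≤s z≤n

balanced-m3 : ∀ {n} → 3 ≤ n → BalancedWord n 3
balanced-m3 {suc (suc (suc k))} (s≤s (s≤s (s≤s _))) = fromBlocks (threeBlocks k) 2
  (descDesc-run 0 (3 + k) ∷ descDesc-run 1 (2 + k) ∷ descAsc-run 2 (1 + k) ∷ [])
  threeBlocks-sum ≤-refl

-- For n = 4 + k:  n-1,…,0 | 0, n-1,…,1 | 1, 0, n-1,…,2 | 2, 1, 0, 3,…,n-1.  Inside wins 3.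
fourBlocks : ℕ → List (List ℕ)
fourBlocks k = descDesc 0 (4 + k) ∷ descDesc 1 (3 + k) ∷ descDesc 2 (2 + k) ∷ descAsc 3 (1 + k) ∷ []

fourBlocks-sum : ∀ {k i j} → CyclicSucc (4 + k) i j → sum (map (wordWins i j) (fourBlocks k)) ≡ 3
fourBlocks-sum {k} {i} (step lt) = case i lt
  where
  values : ∀ {i} → suc i < 4 + k → Pointwise (λ B v → wordWins i (suc i) B ≡ v) (fourBlocks k) _
  values lt = descDesc-step 0 (4 + k) lt ∷ descDesc-step 1 (3 + k) lt ∷ descDesc-step 2 (2 + k) lt ∷
              descAsc-step 3 (1 + k) lt ∷ []
  case : ∀ i (lt : suc i < 4 + k) → sum (map (wordWins i (suc i)) (fourBlocks k)) ≡ 3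
  case zero          lt = sum-map-≡ _ (fourBlocks k) (values lt)
  case (suc zero)    lt = sum-map-≡ _ (fourBlocks k) (values lt)
  case (suc (suc i)) lt = sum-map-≡ _ (fourBlocks k) (values lt)
fourBlocks-sum {k} wrap = sum-map-≡ (wordWins (3 + k) 0) (fourBlocks k)
  (descDesc-wrap 0 (4 + k) 1≤ z≤n (n<1+n _) ∷ descDesc-wrap 1 (3 + k) 1≤ 1≤ (n<1+n _) ∷
   descDesc-wrap 2 (2 + k) 1≤ (s≤s (s≤s z≤n)) (n<1+n _) ∷
   descAsc-wrap 3 (1 + k) 1≤ (s≤s (s≤s (s≤s z≤n))) (n<1+n _) ∷ [])
  where
  1≤ : 1 ≤ 3 + k
  1≤ = s≤s z≤n

-- Three 4-sided dice cannot come from blocks: a block on three letters has at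
-- most two inside wins summed over the three cyclic pairs, so four blocks give
-- each pair at most 2 + 6 = 8 wins, while more than 16/2 are needed.
threeDiceFourFaces : List ℕ
threeDiceFourFaces = 0 ∷ 1 ∷ 0 ∷ 2 ∷ 2 ∷ 2 ∷ 1 ∷ 1 ∷ 1 ∷ 0 ∷ 2 ∷ 0 ∷ []

balanced-n3-m4 : BalancedWord 3 4
balanced-n3-m4 = record
  { word        = threeDiceFourFaces
  ; winCount    = 9
  ; length-word = refl
  ; letters     = from-yes (All.all? (_<? 3) threeDiceFourFaces)
  ; counts      = counts
  ; balanced    = balanced
  ; majority    = n≤1+n 17
  }
  where
  counts : ∀ {c} → c < 3 → count c threeDiceFourFaces ≡ 4
  counts {0} _ = refl
  counts {1} _ = refl
  counts {2} _ = refl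
  counts {suc (suc (suc _))} (s≤s (s≤s (s≤s ())))

  balanced : ∀ {i j} → CyclicSucc 3 i j → wordWins i j threeDiceFourFaces ≡ 9
  balanced {0} (step _) = refl
  balanced {1} (step _) = refl
  balanced {suc (suc _)} (step (s≤s (s≤s (s≤s ()))))
  balanced wrap = refl

balanced-m4 : ∀ {n} → 3 ≤ n → BalancedWord n 4
balanced-m4 {1} (s≤s ())
balanced-m4 {2} (s≤s (s≤s ()))
balanced-m4 {3} _ = balanced-n3-m4
balanced-m4 {suc (suc (suc (suc k)))} _ = fromBlocks (fourBlocks k) 3
  (descDesc-run 0 (4 + k) ∷ descDesc-run 1 (3 + k) ∷ descDesc-run 2 (2 + k) ∷ descAsc-run 3 (1 + k) ∷ [])
  fourBlocks-sum (n≤1+n 17)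

balancedWord : ∀ {n} m → 3 ≤ n → 3 ≤ m → BalancedWord n m
balancedWord 1 _ (s≤s ())
balancedWord 2 _ (s≤s (s≤s ()))
balancedWord 3 3≤n _ = balanced-m3 3≤n
balancedWord 4 3≤n _ = balanced-m4 3≤n
balancedWord (suc (suc m@(suc (suc (suc _))))) 3≤n _ =
  extend (≤-trans (n≤1+n 2) 3≤n) (balancedWord m 3≤n (s≤s (s≤s (s≤s z≤n))))

module _ {N : ℕ} where

  inverted? : (p : Fin N × Fin N) → Dec (toℕ (proj₂ p) < toℕ (proj₁ p))
  inverted? p = toℕ (proj₂ p) <? toℕ (proj₁ p)

  inversions : List (Fin N) → List (Fin N) → ℕ
  inversions xs ys = length (filter inverted? (cartesianProduct xs ys))

  Ascending : List (Fin N) → Set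
  Ascending = AllPairs (λ a b → toℕ a < toℕ b)

  inversions-∷ˡ : ∀ x xs ys →
    inversions (x ∷ xs) ys ≡ length (filter inverted? (map (x ,_) ys)) + inversions xs ys
  inversions-∷ˡ x xs ys = trans (cong length (filter-++ inverted? (map (x ,_) ys) (cartesianProduct xs ys)))
                                (length-++ (filter inverted? (map (x ,_) ys)))

  inversions-smallest-left : ∀ x xs ys → All (λ y → toℕ x < toℕ y) ys → inversions (x ∷ xs) ys ≡ inversions xs ys
  inversions-smallest-left x xs ys x<ys = trans (inversions-∷ˡ x xs ys)
    (cong (λ b → length b + inversions xs ys) (filter-none inverted? (map⁺ (All.map <⇒≯ x<ys))))

  inversions-smallest-right : ∀ y xs ys → All (λ x → toℕ y < toℕ x) xs →
                              inversions xs (y ∷ ys) ≡ length xs + inversions xs ys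
  inversions-smallest-right y []       ys []           = refl
  inversions-smallest-right y (x ∷ xs) ys (y<x ∷ y<xs) = begin
    inversions (x ∷ xs) (y ∷ ys)
      ≡⟨ inversions-∷ˡ x xs (y ∷ ys) ⟩
    length (filter inverted? ((x , y) ∷ map (x ,_) ys)) + inversions xs (y ∷ ys)
      ≡⟨ cong (λ b → length b + inversions xs (y ∷ ys)) (filter-accept inverted? y<x) ⟩
    suc (length (filter inverted? (map (x ,_) ys))) + inversions xs (y ∷ ys)
      ≡⟨ cong (suc (length (filter inverted? (map (x ,_) ys))) +_) (inversions-smallest-right y xs ys y<xs) ⟩
    suc (length (filter inverted? (map (x ,_) ys))) + (length xs + inversions xs ys)
      ≡⟨ regroup (length (filter inverted? (map (x ,_) ys))) (length xs) (inversions xs ys) ⟩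
    suc (length xs) + (length (filter inverted? (map (x ,_) ys)) + inversions xs ys)
      ≡⟨ cong (suc (length xs) +_) (inversions-∷ˡ x xs ys) ⟨
    suc (length xs) + inversions (x ∷ xs) ys ∎
    where
    open ≡-Reasoning
    regroup : ∀ a b c → suc a + (b + c) ≡ suc b + (a + c)
    regroup = solve-∀

allFin-ascending : ∀ N → Ascending (allFin N)
allFin-ascending N = tabulate⁺-< id

module _ {N n : ℕ} (f : Fin N → Fin n) where

  preimage : Fin n → List (Fin N) → List (Fin N)
  preimage i ks = filter (λ k → f k ≟ᶠ i) ks

  labels : List (Fin N) → List ℕ
  labels ks = map (toℕ ∘ f) ks

  length-preimage : ∀ i ks → length (preimage i ks) ≡ count (toℕ i) (labels ks)
  length-preimage i []       = refl
  length-preimage i (k ∷ ks) with f k ≟ᶠ i | toℕ (f k) ≟ toℕ i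
  ... | yes _    | yes _    = cong suc (length-preimage i ks)
  ... | yes fk≡i | no  fk≢i = contradiction (cong toℕ fk≡i) fk≢i
  ... | no  fk≢i | yes fk≡i = contradiction (toℕ-injective fk≡i) fk≢i
  ... | no  _    | no  _    = length-preimage i ks

  inversions-preimage : ∀ {i j} → i ≢ j → ∀ ks → Ascending ks →
    inversions (preimage i ks) (preimage j ks) ≡ wordWins (toℕ i) (toℕ j) (labels ks)
  inversions-preimage i≢j []       []            = refl
  inversions-preimage {i} {j} i≢j (k ∷ ks) (k<ks ∷ asc-ks) with f k ≟ᶠ i | f k ≟ᶠ j | toℕ (f k) ≟ toℕ j
  ... | yes fk≡i | yes fk≡j | _        = contradiction (trans (sym fk≡i) fk≡j) i≢j
  ... | _        | yes fk≡j | no  fk≢j = contradiction (cong toℕ fk≡j) fk≢j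
  ... | _        | no  fk≢j | yes fk≡j = contradiction (toℕ-injective fk≡j) fk≢j
  ... | yes _    | no  _    | no  _    =
    trans (inversions-smallest-left k (preimage i ks) (preimage j ks) (filter⁺ _ k<ks))
          (inversions-preimage i≢j ks asc-ks)
  ... | no  _    | yes _    | yes _    = begin
    inversions (preimage i ks) (k ∷ preimage j ks)
      ≡⟨ inversions-smallest-right k (preimage i ks) (preimage j ks) (filter⁺ _ k<ks) ⟩
    length (preimage i ks) + inversions (preimage i ks) (preimage j ks)
      ≡⟨ cong₂ _+_ (length-preimage i ks) (inversions-preimage i≢j ks asc-ks) ⟩
    count (toℕ i) (labels ks) + wordWins (toℕ i) (toℕ j) (labels ks) ∎
    where open ≡-Reasoning
  ... | no  _    | no  _    | no  _    = inversions-preimage i≢j ks asc-ks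

-- The p-th letter of a word, 0 past its end.
nth : List ℕ → ℕ → ℕ
nth []      _       = 0
nth (x ∷ w) zero    = x
nth (x ∷ w) (suc p) = nth w p

nth-< : ∀ {n w} → 0 < n → All (_< n) w → ∀ p → nth w p < n
nth-< 0<n []        p       = 0<n
nth-< 0<n (x<n ∷ _) zero    = x<n
nth-< 0<n (_ ∷ w<n) (suc p) = nth-< 0<n w<n p

tabulate-nth : ∀ w {L} → length w ≡ L → tabulate {n = L} (λ k → nth w (toℕ k)) ≡ w
tabulate-nth []      refl = refl
tabulate-nth (x ∷ w) refl = cong (x ∷_) (tabulate-nth w refl)

next-cyclic : ∀ {n} (i : Fin n) → CyclicSucc n (toℕ i) (toℕ (next i))
next-cyclic {n} i with suc (toℕ i) <? n
... | yes i+1<n = subst (CyclicSucc n (toℕ i)) (sym (toℕ-fromℕ< i+1<n)) (step i+1<n)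
... | no  i+1≮n = subst (CyclicSucc n (toℕ i)) (sym (toℕ-fromℕ< _))
                    (subst (λ n′ → CyclicSucc n′ (toℕ i) 0) (≤-antisym (toℕ<n i) (≮⇒≥ i+1≮n)) wrap)

cyclic-irreflexive : ∀ {n i j} → 2 ≤ n → CyclicSucc n i j → i ≢ j
cyclic-irreflexive _        (step _) = 1+n≢n ∘ sym
cyclic-irreflexive (s≤s ()) wrap refl

realise : ∀ {n m} → 2 ≤ n → BalancedWord n m →
  Σ (Assignment n m) λ die →
    ((i : Fin n) → size die i ≡ m)
    × ((i : Fin n) → Beats die i (next i))
    × ((i j : Fin n) → wins die i (next i) ≡ wins die j (next j))
realise {n} {m} 2≤n b = die , sizes , beats , equal
  where
  open BalancedWord b

  die : Assignment n m
  die k = fromℕ< (nth-< (≤-trans (s≤s z≤n) 2≤n) letters (toℕ k))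

  labels-die : labels die (allFin (n * m)) ≡ word
  labels-die = begin
    map (toℕ ∘ die) (allFin (n * m))   ≡⟨ map-tabulate id (toℕ ∘ die) ⟩
    tabulate (toℕ ∘ die)               ≡⟨ tabulate-cong (λ k → toℕ-fromℕ< _) ⟩
    tabulate (λ k → nth word (toℕ k))  ≡⟨ tabulate-nth word length-word ⟩
    word                               ∎
    where open ≡-Reasoning

  sizes : (i : Fin n) → size die i ≡ m
  sizes i = trans (length-preimage die i (allFin (n * m)))
                  (trans (cong (count (toℕ i)) labels-die) (counts (toℕ<n i)))

  wins-next : (i : Fin n) → wins die i (next i) ≡ winCount
  wins-next i = trans
    (inversions-preimage die (cyclic-irreflexive 2≤n (next-cyclic i) ∘ cong toℕ) (allFin (n * m)) (allFin-ascending _))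
    (trans (cong (wordWins (toℕ i) (toℕ (next i))) labels-die) (balanced (next-cyclic i)))

  beats : (i : Fin n) → Beats die i (next i)
  beats i = subst (λ w → m * m < 2 * w) (sym (wins-next i)) majority

  equal : (i j : Fin n) → wins die i (next i) ≡ wins die j (next j)
  equal i j = trans (wins-next i) (sym (wins-next j))

theorem2 : (n m : ℕ) → n ≥ 3 → m ≥ 3 →
    Σ (Assignment n m) λ die →
    ((i : Fin n) → size die i ≡ m)
    × ((i : Fin n) → Beats die i (next i))
    × ((i j : Fin n) → wins die i (next i) ≡ wins die j (next j))
theorem2 n m n≥3 m≥3 = realise (≤-trans (n≤1+n 2) n≥3) (balancedWord m n≥3 m≥3)
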